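{- The variety $\mathrm{Eq}(\mathsf{FMA})$ is locally finite.
   Context: A closure algebra is a pair $\langle B,f\rangle$, $B$ a Boolean algebra, with $f(0)=0$, $f(a+b)=f(a)+f(b)$, $a\le f(a)$, $f(f(a))=f(a)$; $x$ is closed if $f(x)=x$. A closure algebra $\langle B,f\rangle$ is a filter algebra if either it is the trivial algebra or the two-element closure algebra, or its set of closed elements has the form $\{0\}\cup F$ for a filter $F$ of $B$ with $F\neq\{1\}$. $\mathsf{FMA}$ is the class of filter algebras, $\mathrm{Eq}(\mathbf K)=\mathbf{HSP}(\mathbf K)$ the variety generated by $\mathbf K$. A class is locally finite if every finitely generated member is finite. -}

module Defs where

open import Level using (0ℓ)
open import Algebra.Lattice.Bundles using (BooleanAlgebra)
open import Data.Nat using (ℕ)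
open import Data.Fin using (Fin)
open import Data.Product using (Σ; ∃; _×_; _,_)
open import Data.Sum using (_⊎_)
open import Relation.Nullary renaming (¬_ to Not)

record ClosureAlgebra : Set₁ where
  field
    BA : BooleanAlgebra 0ℓ 0ℓ
  open BooleanAlgebra BA public
  field
    f      : Carrier → Carrier
    f-cong : ∀ {x y} → x ≈ y → f x ≈ f y
    f-⊥    : f ⊥ ≈ ⊥
    f-∨    : ∀ a b → f (a ∨ b) ≈ f a ∨ f b
    f-incr : ∀ a → a ∧ f a ≈ a
    f-idem : ∀ a → f (f a) ≈ f a

module _ (A : ClosureAlgebra) where
  open ClosureAlgebra A

  Closed : Carrier → Set
  Closed x = f x ≈ x

  record IsFilter (F : Carrier → Set) : Set where
    field
      resp    : ∀ {x y} → x ≈ y → F x → F y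
      has-⊤   : F ⊤
      up      : ∀ {x y} → F x → x ∧ y ≈ x → F y
      meet    : ∀ {x y} → F x → F y → F (x ∧ y)

  Trivial : Set
  Trivial = ∀ x y → x ≈ y

  -- exactly two elements (then f is necessarily the identity, so this is
  -- the two-element closure algebra up to isomorphism)
  TwoElement : Set
  TwoElement = Not (⊤ ≈ ⊥) × (∀ x → x ≈ ⊥ ⊎ x ≈ ⊤)

  ClosedAreZeroOrFilter : Set₁
  ClosedAreZeroOrFilter =
    Σ (Carrier → Set) λ F →
      IsFilter F
      × Not (∀ x → F x → x ≈ ⊤)
      × (∀ x → (Closed x → (x ≈ ⊥ ⊎ F x)) × ((x ≈ ⊥ ⊎ F x) → Closed x))

FMA : ClosureAlgebra → Set₁
FMA A = Trivial A ⊎ TwoElement A ⊎ ClosedAreZeroOrFilter A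

record Hom (A B : ClosureAlgebra) : Set where
  private
    module A = ClosureAlgebra A
    module B = ClosureAlgebra B
  field
    map    : A.Carrier → B.Carrier
    cong   : ∀ {x y} → x A.≈ y → map x B.≈ map y
    pres-∨ : ∀ x y → map (x A.∨ y) B.≈ map x B.∨ map y
    pres-∧ : ∀ x y → map (x A.∧ y) B.≈ map x B.∧ map y
    pres-¬ : ∀ x → map (A.¬ x) B.≈ B.¬ map x
    pres-⊤ : map A.⊤ B.≈ B.⊤
    pres-⊥ : map A.⊥ B.≈ B.⊥
    pres-f : ∀ x → map (A.f x) B.≈ B.f (map x)

module _ {A B : ClosureAlgebra} (h : Hom A B) where
  private
    module A = ClosureAlgebra A
    module B = ClosureAlgebra B
  open Hom h

  Injective : Set
  Injective = ∀ {x y} → map x B.≈ map y → x A.≈ y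

  Surjective : Set
  Surjective = ∀ b → ∃ λ a → map a B.≈ b

Class : Set₂
Class = ClosureAlgebra → Set₁

H : Class → Class
H K A = Σ ClosureAlgebra λ B → K B × Σ (Hom B A) Surjective

-- subalgebras (up to isomorphism: embeddings)
S : Class → Class
S K A = Σ ClosureAlgebra λ B → K B × Σ (Hom A B) Injective

-- A is (isomorphic to) the direct product of a family (Bᵢ)ᵢ∈I:
-- there are homomorphisms πᵢ : A → Bᵢ such that a ↦ (πᵢ a)ᵢ is a bijection
-- onto ∏ᵢ Bᵢ.
IsProductOf : (A : ClosureAlgebra) (I : Set) (B : I → ClosureAlgebra) → Set
IsProductOf A I B =
  Σ ((i : I) → Hom A (B i)) λ π →
      (∀ x y → (∀ i → ClosureAlgebra._≈_ (B i) (Hom.map (π i) x) (Hom.map (π i) y))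
             → ClosureAlgebra._≈_ A x y)
    × (∀ (b : (i : I) → ClosureAlgebra.Carrier (B i)) →
         ∃ λ x → ∀ i → ClosureAlgebra._≈_ (B i) (Hom.map (π i) x) (b i))

P : Class → Class
P K A = Σ Set λ I → Σ (I → ClosureAlgebra) λ B → (∀ i → K (B i)) × IsProductOf A I B

Eq : Class → Class
Eq K = λ A → H (S (P K)) A

data Term (n : ℕ) : Set where
  var       : Fin n → Term n
  _∨ₜ_ _∧ₜ_ : Term n → Term n → Term n
  ¬ₜ_ fₜ    : Term n → Term n
  ⊤ₜ ⊥ₜ     : Term n

module _ (A : ClosureAlgebra) where
  open ClosureAlgebra A

  ⟦_⟧ : ∀ {n} → Term n → (Fin n → Carrier) → Carrier
  ⟦ var i ⟧ g = g i
  ⟦ s ∨ₜ t ⟧ g = ⟦ s ⟧ g ∨ ⟦ t ⟧ g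
  ⟦ s ∧ₜ t ⟧ g = ⟦ s ⟧ g ∧ ⟦ t ⟧ g
  ⟦ ¬ₜ t ⟧ g = ¬ ⟦ t ⟧ g
  ⟦ fₜ t ⟧ g = f (⟦ t ⟧ g)
  ⟦ ⊤ₜ ⟧ g = ⊤
  ⟦ ⊥ₜ ⟧ g = ⊥

  FinitelyGenerated : Set
  FinitelyGenerated =
    Σ ℕ λ n → Σ (Fin n → Carrier) λ g → ∀ a → ∃ λ (t : Term n) → ⟦ t ⟧ g ≈ a

  Finite : Set
  Finite = Σ ℕ λ m → Σ (Fin m → Carrier) λ e → ∀ a → ∃ λ i → e i ≈ a

LocallyFinite : Class → Set₁
LocallyFinite K = ∀ A → K A → FinitelyGenerated A → Finite A

{-# OPTIONS --safe #-}

-- In a filter algebra the closed elements other than ⊥ form an upset F of closed elements.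
-- For generators γ with atoms α, let leakage be the join of all f α ∧ ¬ α and f ¬ α ∧ α.
-- Since q ∨ y is closed for q ∈ F, leakage lies below every element of F, so leakage ∧ f w
-- is ⊥ or leakage for every w. Splitting the atoms along leakage into cells c gives
-- f c = c ∨ spill c with spill c = leakage ∧ f c. A Boolean combination x of γ, leakage and
-- the spills is constant on each cell c, and below spill c ≤ leakage it agrees with the
-- combination x′ obtained by fixing γ and leakage to their values on c (and the spills to ⊥
-- when c lies outside leakage); hence f (c ∧ x) = (c ∧ x) ∨ (spill c ∧ x′).
-- As x is the join of the c ∧ x, f maps Boolean combinations of these finitely many terms
-- to such combinations, uniformly over all filter algebras. The resulting identities survive
-- H, S and P, so an algebra in Eq(FMA) generated by γ consists of finitely many term values.
module Submission where

open import Defs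
open import Level using (0ℓ)
open import Algebra.Lattice.Bundles using (BooleanAlgebra)
import Algebra.Lattice.Properties.BooleanAlgebra as BooleanAlgebraProperties
import Algebra.Lattice.Properties.BooleanAlgebra.Expression as BooleanExpression
open import Data.Bool as Bool using (Bool; true; false)
open import Data.Fin using (Fin; zero; suc)
open import Data.Fin.Patterns using (0F; 1F; 2F; 3F)
import Data.List as List
open import Data.List using (List; length; []; _∷_; _++_; cartesianProductWith; allFin)
open import Data.List.Membership.Propositional using (_∈_; lose)
open import Data.List.Membership.Propositional.Properties
  using (∈-allFin; ∈-cartesianProductWith⁺; ∈-map⁺; ∈-++⁺ˡ; ∈-++⁺ʳ)
open import Data.List.Relation.Unary.Any using (Any; here; there; index)
open import Data.List.Relation.Unary.Any.Properties using (lookup-index)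
open import Data.Maybe using (Maybe; just; nothing; maybe′)
open import Data.Nat using (ℕ; zero; suc)
open import Data.Unit using (tt) renaming (⊤ to Unit)
open import Data.Product using (Σ; ∃; _,_; proj₁; proj₂)
open import Data.Sum using (_⊎_; inj₁; inj₂)
open import Data.Vec using (Vec; []; _∷_; lookup)
open import Function using (_∘_)
open import Function.Identity.Effectful using (applicative)
open import Relation.Binary.Definitions using (DecidableEquality)
import Relation.Binary.Lattice as OrderTheoretic
open import Relation.Binary.PropositionalEquality as ≡ using (_≡_)
import Relation.Binary.Reasoning.Setoid as SetoidReasoning
open import Relation.Nullary.Decidable using (True; toWitness; map′; _×-dec_)

module DecisionTree {X : Set} where

  data Tree : List X → Set where
    leaf : Bool → Tree []
    node : ∀ {x xs} → Tree xs → Tree xs → Tree (x ∷ xs)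

  constᵗ : ∀ {xs} → Bool → Tree xs
  constᵗ {[]}    b = leaf b
  constᵗ {_ ∷ _} b = node (constᵗ b) (constᵗ b)

  _∨ᵗ_ _∧ᵗ_ : ∀ {xs} → Tree xs → Tree xs → Tree xs
  leaf a     ∨ᵗ leaf b     = leaf (a Bool.∨ b)
  node a₁ a₀ ∨ᵗ node b₁ b₀ = node (a₁ ∨ᵗ b₁) (a₀ ∨ᵗ b₀)
  leaf a     ∧ᵗ leaf b     = leaf (a Bool.∧ b)
  node a₁ a₀ ∧ᵗ node b₁ b₀ = node (a₁ ∧ᵗ b₁) (a₀ ∧ᵗ b₀)

  ¬ᵗ_ : ∀ {xs} → Tree xs → Tree xs
  ¬ᵗ leaf a     = leaf (Bool.not a)
  ¬ᵗ node a₁ a₀ = node (¬ᵗ a₁) (¬ᵗ a₀)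

  varᵗ : ∀ {x xs} → x ∈ xs → Tree xs
  varᵗ (here _)  = node (constᵗ true) (constᵗ false)
  varᵗ (there p) = node (varᵗ p) (varᵗ p)

  restrict : ∀ {xs} → (X → Maybe Bool) → Tree xs → Tree xs
  restrict π (leaf a) = leaf a
  restrict π (node {x} a₁ a₀) with π x
  ... | just true  = node (restrict π a₁) (restrict π a₁)
  ... | just false = node (restrict π a₀) (restrict π a₀)
  ... | nothing    = node (restrict π a₁) (restrict π a₀)

  trees : (xs : List X) → List (Tree xs)
  trees []       = leaf true ∷ leaf false ∷ []
  trees (_ ∷ xs) = cartesianProductWith node (trees xs) (trees xs)

  ∈-trees : ∀ {xs} (a : Tree xs) → a ∈ trees xs
  ∈-trees (leaf true)  = here ≡.refl
  ∈-trees (leaf false) = there (here ≡.refl)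
  ∈-trees (node a₁ a₀) = ∈-cartesianProductWith⁺ node (∈-trees a₁) (∈-trees a₀)

  _≟ᵗ_ : ∀ {xs} → DecidableEquality (Tree xs)
  leaf a     ≟ᵗ leaf b     = map′ (≡.cong leaf) (λ { ≡.refl → ≡.refl }) (a Bool.≟ b)
  node a₁ a₀ ≟ᵗ node b₁ b₀ =
    map′ (λ (p , q) → ≡.cong₂ node p q) (λ { ≡.refl → ≡.refl , ≡.refl }) ((a₁ ≟ᵗ b₁) ×-dec (a₀ ≟ᵗ b₀))

module BooleanAlgebraFacts (B : BooleanAlgebra 0ℓ 0ℓ) where

  open BooleanAlgebra B public
  open BooleanAlgebraProperties B public
    using (∧-idem; ∧-identityˡ; ∧-identityʳ; ∧-zeroˡ; ∧-zeroʳ;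
           ∨-identityˡ; ∨-identityʳ; ∨-zeroˡ; ¬⊥≈⊤; ¬⊤≈⊥; ¬-involutive; deMorgan₁)
  open OrderTheoretic.Lattice (BooleanAlgebraProperties.∨-∧-orderTheoreticLattice B) public
    using (_≤_; x≤x∨y; y≤x∨y; ∨-least; x∧y≤x; x∧y≤y; ∧-greatest)
    renaming (trans to ≤-trans; ≲-respˡ-≈ to ≤-respˡ-≈; ≲-respʳ-≈ to ≤-respʳ-≈)
  open SetoidReasoning setoid public

  infix 4 _≈[_]_

  _≈[_]_ : Carrier → Carrier → Carrier → Set
  a ≈[ e ] b = e ∧ a ≈ e ∧ b

  ≈[]-∨-cong : ∀ {e a b c d} → a ≈[ e ] b → c ≈[ e ] d → a ∨ c ≈[ e ] b ∨ d
  ≈[]-∨-cong {e} {a} {b} {c} {d} p q = begin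
    e ∧ (a ∨ c)        ≈⟨ ∧-distribˡ-∨ e a c ⟩
    e ∧ a ∨ e ∧ c      ≈⟨ ∨-cong p q ⟩
    e ∧ b ∨ e ∧ d      ≈⟨ ∧-distribˡ-∨ e b d ⟨
    e ∧ (b ∨ d)        ∎

  ∧-distribˡ-∧ : ∀ e a b → e ∧ (a ∧ b) ≈ (e ∧ a) ∧ (e ∧ b)
  ∧-distribˡ-∧ e a b = begin
    e ∧ (a ∧ b)         ≈⟨ ∧-congʳ (∧-idem e) ⟨
    (e ∧ e) ∧ (a ∧ b)   ≈⟨ ∧-assoc e e (a ∧ b) ⟩
    e ∧ (e ∧ (a ∧ b))   ≈⟨ ∧-congˡ (∧-assoc e a b) ⟨
    e ∧ ((e ∧ a) ∧ b)   ≈⟨ ∧-congˡ (∧-comm (e ∧ a) b) ⟩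
    e ∧ (b ∧ (e ∧ a))   ≈⟨ ∧-assoc e b (e ∧ a) ⟨
    (e ∧ b) ∧ (e ∧ a)   ≈⟨ ∧-comm (e ∧ b) (e ∧ a) ⟩
    (e ∧ a) ∧ (e ∧ b)   ∎

  ≈[]-∧-cong : ∀ {e a b c d} → a ≈[ e ] b → c ≈[ e ] d → a ∧ c ≈[ e ] b ∧ d
  ≈[]-∧-cong {e} {a} {b} {c} {d} p q = begin
    e ∧ (a ∧ c)         ≈⟨ ∧-distribˡ-∧ e a c ⟩
    (e ∧ a) ∧ (e ∧ c)   ≈⟨ ∧-cong p q ⟩
    (e ∧ b) ∧ (e ∧ d)   ≈⟨ ∧-distribˡ-∧ e b d ⟨
    e ∧ (b ∧ d)         ∎

  ∧-¬-relative : ∀ e a → e ∧ ¬ a ≈ e ∧ ¬ (e ∧ a)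
  ∧-¬-relative e a = begin
    e ∧ ¬ a               ≈⟨ ∨-identityˡ _ ⟨
    ⊥ ∨ e ∧ ¬ a           ≈⟨ ∨-congʳ (∧-complementʳ e) ⟨
    e ∧ ¬ e ∨ e ∧ ¬ a     ≈⟨ ∧-distribˡ-∨ e (¬ e) (¬ a) ⟨
    e ∧ (¬ e ∨ ¬ a)       ≈⟨ ∧-congˡ (deMorgan₁ e a) ⟨
    e ∧ ¬ (e ∧ a)         ∎

  ≈[]-¬-cong : ∀ {e a b} → a ≈[ e ] b → ¬ a ≈[ e ] ¬ b
  ≈[]-¬-cong {e} {a} {b} p = begin
    e ∧ ¬ a          ≈⟨ ∧-¬-relative e a ⟩
    e ∧ ¬ (e ∧ a)    ≈⟨ ∧-congˡ (¬-cong p) ⟩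
    e ∧ ¬ (e ∧ b)    ≈⟨ ∧-¬-relative e b ⟨
    e ∧ ¬ b          ∎

  ⊥≤ : ∀ x → ⊥ ≤ x
  ⊥≤ x = sym (∧-zeroˡ x)

  ≤⊥⇒≈⊥ : ∀ {x} → x ≤ ⊥ → x ≈ ⊥
  ≤⊥⇒≈⊥ {x} x≤⊥ = trans x≤⊥ (∧-zeroʳ x)

  ¬≈⊥⇒≈⊤ : ∀ {x} → ¬ x ≈ ⊥ → x ≈ ⊤
  ¬≈⊥⇒≈⊤ {x} ¬x≈⊥ = trans (sym (¬-involutive x)) (trans (¬-cong ¬x≈⊥) ¬⊥≈⊤)

  split : ∀ x a → a ≈ x ∧ a ∨ ¬ x ∧ a
  split x a = begin
    a                  ≈⟨ ∧-identityˡ a ⟨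
    ⊤ ∧ a              ≈⟨ ∧-congʳ (∨-complementʳ x) ⟨
    (x ∨ ¬ x) ∧ a      ≈⟨ ∧-distribʳ-∨ a x (¬ x) ⟩
    x ∧ a ∨ ¬ x ∧ a    ∎

  ≈-by-cases : ∀ x {a b} → a ≈[ x ] b → a ≈[ ¬ x ] b → a ≈ b
  ≈-by-cases x {a} {b} p q = begin
    a                  ≈⟨ split x a ⟩
    x ∧ a ∨ ¬ x ∧ a    ≈⟨ ∨-cong p q ⟩
    x ∧ b ∨ ¬ x ∧ b    ≈⟨ split x b ⟨
    b                  ∎

  ≈[]-mono : ∀ {e e′ a b} → e′ ≤ e → a ≈[ e ] b → a ≈[ e′ ] b
  ≈[]-mono {e} {e′} {a} {b} e′≤e p = begin
    e′ ∧ a          ≈⟨ ∧-congʳ e′≤e ⟩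
    (e′ ∧ e) ∧ a    ≈⟨ ∧-assoc e′ e a ⟩
    e′ ∧ (e ∧ a)    ≈⟨ ∧-congˡ p ⟩
    e′ ∧ (e ∧ b)    ≈⟨ ∧-assoc e′ e b ⟨
    (e′ ∧ e) ∧ b    ≈⟨ ∧-congʳ e′≤e ⟨
    e′ ∧ b          ∎

  bit : Bool → Carrier
  bit true  = ⊤
  bit false = ⊥

  IsBit : Carrier → Set
  IsBit x = x ≈ ⊤ ⊎ x ≈ ⊥

  bit-isBit : ∀ b → IsBit (bit b)
  bit-isBit true  = inj₁ refl
  bit-isBit false = inj₂ refl

  isBit-resp : ∀ {a b} → a ≈ b → IsBit a → IsBit b
  isBit-resp a≈b (inj₁ a≈⊤) = inj₁ (trans (sym a≈b) a≈⊤)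
  isBit-resp a≈b (inj₂ a≈⊥) = inj₂ (trans (sym a≈b) a≈⊥)

  ∧-isBit : ∀ {a b} → IsBit a → IsBit b → IsBit (a ∧ b)
  ∧-isBit (inj₁ a≈⊤) b-bit = isBit-resp (sym (trans (∧-congʳ a≈⊤) (∧-identityˡ _))) b-bit
  ∧-isBit (inj₂ a≈⊥) b-bit = inj₂ (trans (∧-congʳ a≈⊥) (∧-zeroˡ _))

  ¬-isBit : ∀ {a} → IsBit a → IsBit (¬ a)
  ¬-isBit (inj₁ a≈⊤) = inj₂ (trans (¬-cong a≈⊤) ¬⊤≈⊥)
  ¬-isBit (inj₂ a≈⊥) = inj₁ (trans (¬-cong a≈⊥) ¬⊥≈⊤)

  ite : Carrier → Carrier → Carrier → Carrier
  ite x a b = x ∧ a ∨ ¬ x ∧ b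

  ite-cong : ∀ {x y a b c d} → x ≈ y → a ≈ b → c ≈ d → ite x a c ≈ ite y b d
  ite-cong p q r = ∨-cong (∧-cong p q) (∧-cong (¬-cong p) r)

  ite-≈[]-then : ∀ x a b → ite x a b ≈[ x ] a
  ite-≈[]-then x a b = begin
    x ∧ (x ∧ a ∨ ¬ x ∧ b)            ≈⟨ ∧-distribˡ-∨ x _ _ ⟩
    x ∧ (x ∧ a) ∨ x ∧ (¬ x ∧ b)      ≈⟨ ∨-cong (∧-assoc x x a) (∧-assoc x (¬ x) b) ⟨
    (x ∧ x) ∧ a ∨ (x ∧ ¬ x) ∧ b      ≈⟨ ∨-cong (∧-congʳ (∧-idem x)) (∧-congʳ (∧-complementʳ x)) ⟩
    x ∧ a ∨ ⊥ ∧ b                    ≈⟨ ∨-congˡ (∧-zeroˡ b) ⟩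
    x ∧ a ∨ ⊥                        ≈⟨ ∨-identityʳ _ ⟩
    x ∧ a                            ∎

  ite-≈[]-else : ∀ x a b → ite x a b ≈[ ¬ x ] b
  ite-≈[]-else x a b = begin
    ¬ x ∧ (x ∧ a ∨ ¬ x ∧ b)              ≈⟨ ∧-distribˡ-∨ (¬ x) _ _ ⟩
    ¬ x ∧ (x ∧ a) ∨ ¬ x ∧ (¬ x ∧ b)      ≈⟨ ∨-cong (∧-assoc (¬ x) x a) (∧-assoc (¬ x) (¬ x) b) ⟨
    (¬ x ∧ x) ∧ a ∨ (¬ x ∧ ¬ x) ∧ b      ≈⟨ ∨-cong (∧-congʳ (∧-complementˡ x)) (∧-congʳ (∧-idem (¬ x))) ⟩
    ⊥ ∧ a ∨ ¬ x ∧ b                      ≈⟨ ∨-congʳ (∧-zeroˡ a) ⟩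
    ⊥ ∨ ¬ x ∧ b                          ≈⟨ ∨-identityˡ _ ⟩
    ¬ x ∧ b                              ∎

  ite-unique : ∀ x {a b c} → c ≈[ x ] a → c ≈[ ¬ x ] b → ite x a b ≈ c
  ite-unique x p q =
    ≈-by-cases x (trans (ite-≈[]-then x _ _) (sym p)) (trans (ite-≈[]-else x _ _) (sym q))

  ite-∨ : ∀ x a b c d → ite x a b ∨ ite x c d ≈ ite x (a ∨ c) (b ∨ d)
  ite-∨ x a b c d = sym (ite-unique x
    (≈[]-∨-cong (ite-≈[]-then x a b) (ite-≈[]-then x c d))
    (≈[]-∨-cong (ite-≈[]-else x a b) (ite-≈[]-else x c d)))

  ite-∧ : ∀ x a b c d → ite x a b ∧ ite x c d ≈ ite x (a ∧ c) (b ∧ d)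
  ite-∧ x a b c d = sym (ite-unique x
    (≈[]-∧-cong (ite-≈[]-then x a b) (ite-≈[]-then x c d))
    (≈[]-∧-cong (ite-≈[]-else x a b) (ite-≈[]-else x c d)))

  ite-¬ : ∀ x a b → ¬ ite x a b ≈ ite x (¬ a) (¬ b)
  ite-¬ x a b = sym (ite-unique x
    (≈[]-¬-cong (ite-≈[]-then x a b)) (≈[]-¬-cong (ite-≈[]-else x a b)))

  ite-same : ∀ x a → ite x a a ≈ a
  ite-same x a = sym (split x a)

  ite-⊤-⊥ : ∀ x → ite x ⊤ ⊥ ≈ x
  ite-⊤-⊥ x = begin
    x ∧ ⊤ ∨ ¬ x ∧ ⊥   ≈⟨ ∨-cong (∧-identityʳ x) (∧-zeroʳ (¬ x)) ⟩
    x ∨ ⊥             ≈⟨ ∨-identityʳ x ⟩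
    x                 ∎

  ite-⊤ : ∀ a b → ite ⊤ a b ≈ a
  ite-⊤ a b = begin
    ⊤ ∧ a ∨ ¬ ⊤ ∧ b   ≈⟨ ∨-cong (∧-identityˡ a) (trans (∧-congʳ ¬⊤≈⊥) (∧-zeroˡ b)) ⟩
    a ∨ ⊥             ≈⟨ ∨-identityʳ a ⟩
    a                 ∎

  ite-⊥ : ∀ a b → ite ⊥ a b ≈ b
  ite-⊥ a b = begin
    ⊥ ∧ a ∨ ¬ ⊥ ∧ b   ≈⟨ ∨-cong (∧-zeroˡ a) (trans (∧-congʳ ¬⊥≈⊤) (∧-identityˡ b)) ⟩
    ⊥ ∨ b             ≈⟨ ∨-identityˡ b ⟩
    b                 ∎

  ite-bit : ∀ {x a b} → IsBit x → IsBit a → IsBit b → IsBit (ite x a b)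
  ite-bit (inj₁ x≈⊤) (inj₁ a≈⊤) _ = inj₁ (trans (ite-cong x≈⊤ refl refl) (trans (ite-⊤ _ _) a≈⊤))
  ite-bit (inj₁ x≈⊤) (inj₂ a≈⊥) _ = inj₂ (trans (ite-cong x≈⊤ refl refl) (trans (ite-⊤ _ _) a≈⊥))
  ite-bit (inj₂ x≈⊥) _ (inj₁ b≈⊤) = inj₁ (trans (ite-cong x≈⊥ refl refl) (trans (ite-⊥ _ _) b≈⊤))
  ite-bit (inj₂ x≈⊥) _ (inj₂ b≈⊥) = inj₂ (trans (ite-cong x≈⊥ refl refl) (trans (ite-⊥ _ _) b≈⊥))

module TreeSemantics (B : BooleanAlgebra 0ℓ 0ℓ) {X : Set} where

  open DecisionTree {X}
  open BooleanAlgebraFacts B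

  ⟦_⟧ᵗ : ∀ {xs} → Tree xs → (X → Carrier) → Carrier
  ⟦ leaf a ⟧ᵗ           ρ = bit a
  ⟦ node {x} a₁ a₀ ⟧ᵗ   ρ = ite (ρ x) (⟦ a₁ ⟧ᵗ ρ) (⟦ a₀ ⟧ᵗ ρ)

  ⟦constᵗ⟧ : ∀ {xs} b ρ → ⟦ constᵗ {xs} b ⟧ᵗ ρ ≈ bit b
  ⟦constᵗ⟧ {[]}     b ρ = refl
  ⟦constᵗ⟧ {_ ∷ xs} b ρ = trans (ite-cong refl (⟦constᵗ⟧ {xs} b ρ) (⟦constᵗ⟧ {xs} b ρ)) (ite-same _ _)

  ⟦∨ᵗ⟧ : ∀ {xs} (a b : Tree xs) ρ → ⟦ a ∨ᵗ b ⟧ᵗ ρ ≈ ⟦ a ⟧ᵗ ρ ∨ ⟦ b ⟧ᵗ ρ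
  ⟦∨ᵗ⟧ (leaf true)  (leaf b)     ρ = sym (∨-zeroˡ _)
  ⟦∨ᵗ⟧ (leaf false) (leaf b)     ρ = sym (∨-identityˡ _)
  ⟦∨ᵗ⟧ (node a₁ a₀) (node b₁ b₀) ρ =
    trans (ite-cong refl (⟦∨ᵗ⟧ a₁ b₁ ρ) (⟦∨ᵗ⟧ a₀ b₀ ρ)) (sym (ite-∨ _ _ _ _ _))

  ⟦∧ᵗ⟧ : ∀ {xs} (a b : Tree xs) ρ → ⟦ a ∧ᵗ b ⟧ᵗ ρ ≈ ⟦ a ⟧ᵗ ρ ∧ ⟦ b ⟧ᵗ ρ
  ⟦∧ᵗ⟧ (leaf true)  (leaf b)     ρ = sym (∧-identityˡ _)
  ⟦∧ᵗ⟧ (leaf false) (leaf b)     ρ = sym (∧-zeroˡ _)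
  ⟦∧ᵗ⟧ (node a₁ a₀) (node b₁ b₀) ρ =
    trans (ite-cong refl (⟦∧ᵗ⟧ a₁ b₁ ρ) (⟦∧ᵗ⟧ a₀ b₀ ρ)) (sym (ite-∧ _ _ _ _ _))

  ⟦¬ᵗ⟧ : ∀ {xs} (a : Tree xs) ρ → ⟦ ¬ᵗ a ⟧ᵗ ρ ≈ ¬ ⟦ a ⟧ᵗ ρ
  ⟦¬ᵗ⟧ (leaf true)  ρ = sym ¬⊤≈⊥
  ⟦¬ᵗ⟧ (leaf false) ρ = sym ¬⊥≈⊤
  ⟦¬ᵗ⟧ (node a₁ a₀) ρ = trans (ite-cong refl (⟦¬ᵗ⟧ a₁ ρ) (⟦¬ᵗ⟧ a₀ ρ)) (sym (ite-¬ _ _ _))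

  ⟦varᵗ⟧ : ∀ {x xs} (p : x ∈ xs) ρ → ⟦ varᵗ p ⟧ᵗ ρ ≈ ρ x
  ⟦varᵗ⟧ {xs = _ ∷ xs} (here ≡.refl) ρ =
    trans (ite-cong refl (⟦constᵗ⟧ {xs} true ρ) (⟦constᵗ⟧ {xs} false ρ)) (ite-⊤-⊥ _)
  ⟦varᵗ⟧ (there p) ρ = trans (ite-same _ _) (⟦varᵗ⟧ p ρ)

  override : (X → Carrier) → (X → Maybe Bool) → X → Carrier
  override ρ π x = maybe′ bit (ρ x) (π x)

  ⟦restrict⟧ : ∀ {xs} π (a : Tree xs) ρ → ⟦ restrict π a ⟧ᵗ ρ ≈ ⟦ a ⟧ᵗ (override ρ π)
  ⟦restrict⟧ π (leaf a) ρ = refl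
  ⟦restrict⟧ π (node {x} a₁ a₀) ρ with π x
  ... | just true  = trans (ite-same _ _) (trans (⟦restrict⟧ π a₁ ρ) (sym (ite-⊤ _ _)))
  ... | just false = trans (ite-same _ _) (trans (⟦restrict⟧ π a₀ ρ) (sym (ite-⊥ _ _)))
  ... | nothing    = ite-cong refl (⟦restrict⟧ π a₁ ρ) (⟦restrict⟧ π a₀ ρ)

  ⟦⟧ᵗ-local : ∀ {xs} (a : Tree xs) {e ρ ρ′} → (∀ x → ρ x ≈[ e ] ρ′ x) → ⟦ a ⟧ᵗ ρ ≈[ e ] ⟦ a ⟧ᵗ ρ′
  ⟦⟧ᵗ-local (leaf a)         agree = refl
  ⟦⟧ᵗ-local (node {x} a₁ a₀) agree =
    ≈[]-∨-cong (≈[]-∧-cong (agree x) (⟦⟧ᵗ-local a₁ agree))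
               (≈[]-∧-cong (≈[]-¬-cong (agree x)) (⟦⟧ᵗ-local a₀ agree))

  ⟦⟧ᵗ-isBit : ∀ {xs} (a : Tree xs) {ρ} → (∀ x → IsBit (ρ x)) → IsBit (⟦ a ⟧ᵗ ρ)
  ⟦⟧ᵗ-isBit (leaf a)         bits = bit-isBit a
  ⟦⟧ᵗ-isBit (node {x} a₁ a₀) bits = ite-bit (bits x) (⟦⟧ᵗ-isBit a₁ bits) (⟦⟧ᵗ-isBit a₀ bits)

module BooleanSolver (B : BooleanAlgebra 0ℓ 0ℓ) where

  open BooleanAlgebraFacts B
  open BooleanExpression B public using (Expr; var; _or_; _and_; not; top; bot)
  open BooleanExpression.Semantics B applicative renaming (⟦_⟧ to ⟦_⟧ᵉ)
  open DecisionTree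
  open TreeSemantics B

  normalise : ∀ {k} → Expr k → Tree (allFin k)
  normalise (var i)   = varᵗ (∈-allFin i)
  normalise (a or b)  = normalise a ∨ᵗ normalise b
  normalise (a and b) = normalise a ∧ᵗ normalise b
  normalise (not a)   = ¬ᵗ normalise a
  normalise top       = constᵗ true
  normalise bot       = constᵗ false

  normalise-sound : ∀ {k} (e : Expr k) ρ → ⟦ normalise e ⟧ᵗ (lookup ρ) ≈ ⟦ e ⟧ᵉ ρ
  normalise-sound (var i)   ρ = ⟦varᵗ⟧ (∈-allFin i) (lookup ρ)
  normalise-sound (a or b)  ρ =
    trans (⟦∨ᵗ⟧ (normalise a) (normalise b) _) (∨-cong (normalise-sound a ρ) (normalise-sound b ρ))
  normalise-sound (a and b) ρ =
    trans (⟦∧ᵗ⟧ (normalise a) (normalise b) _) (∧-cong (normalise-sound a ρ) (normalise-sound b ρ))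
  normalise-sound (not a)   ρ = trans (⟦¬ᵗ⟧ (normalise a) _) (¬-cong (normalise-sound a ρ))
  normalise-sound {k} top   ρ = ⟦constᵗ⟧ {xs = allFin k} true _
  normalise-sound {k} bot   ρ = ⟦constᵗ⟧ {xs = allFin k} false _

  solve : ∀ {k} (e₁ e₂ : Expr k) → {True (normalise e₁ ≟ᵗ normalise e₂)} →
          ∀ ρ → ⟦ e₁ ⟧ᵉ ρ ≈ ⟦ e₂ ⟧ᵉ ρ
  solve e₁ e₂ {same} ρ = begin
    ⟦ e₁ ⟧ᵉ ρ                     ≈⟨ normalise-sound e₁ ρ ⟨
    ⟦ normalise e₁ ⟧ᵗ (lookup ρ)  ≡⟨ ≡.cong (λ a → ⟦ a ⟧ᵗ (lookup ρ)) (toWitness same) ⟩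
    ⟦ normalise e₂ ⟧ᵗ (lookup ρ)  ≈⟨ normalise-sound e₂ ρ ⟩
    ⟦ e₂ ⟧ᵉ ρ                     ∎

foldSigns : ∀ {A : Set} {n} → (A → A → A) → (Vec Bool n → A) → A
foldSigns {n = zero}  _∙_ h = h []
foldSigns {n = suc n} _∙_ h = foldSigns _∙_ (h ∘ (true ∷_)) ∙ foldSigns _∙_ (h ∘ (false ∷_))

module Atoms (B : BooleanAlgebra 0ℓ 0ℓ) where

  open BooleanAlgebraFacts B
  open BooleanSolver B

  lit : Bool → Carrier → Carrier
  lit true  x = x
  lit false x = ¬ x

  lit-isBit : ∀ b {x} → IsBit x → IsBit (lit b x)
  lit-isBit true  x-bit = x-bit
  lit-isBit false x-bit = ¬-isBit x-bit

  atom : ∀ {n} → (Fin n → Carrier) → Vec Bool n → Carrier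
  atom γ []      = ⊤
  atom γ (b ∷ s) = lit b (γ zero) ∧ atom (γ ∘ suc) s

  ⋁ : ∀ {n} → (Vec Bool n → Carrier) → Carrier
  ⋁ = foldSigns _∨_

  ⋁-cong : ∀ {n} {h h′ : Vec Bool n → Carrier} → (∀ s → h s ≈ h′ s) → ⋁ h ≈ ⋁ h′
  ⋁-cong {zero}  p = p []
  ⋁-cong {suc n} p = ∨-cong (⋁-cong (p ∘ (true ∷_))) (⋁-cong (p ∘ (false ∷_)))

  ⋁-∨ : ∀ {n} (h h′ : Vec Bool n → Carrier) → ⋁ (λ s → h s ∨ h′ s) ≈ ⋁ h ∨ ⋁ h′
  ⋁-∨ {zero}  h h′ = refl
  ⋁-∨ {suc n} h h′ = trans
    (∨-cong (⋁-∨ (h ∘ (true ∷_)) (h′ ∘ (true ∷_))) (⋁-∨ (h ∘ (false ∷_)) (h′ ∘ (false ∷_))))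
    (solve ((var 0F or var 1F) or (var 2F or var 3F)) ((var 0F or var 2F) or (var 1F or var 3F))
           (⋁ (h ∘ (true ∷_)) ∷ ⋁ (h′ ∘ (true ∷_)) ∷ ⋁ (h ∘ (false ∷_)) ∷ ⋁ (h′ ∘ (false ∷_)) ∷ []))

  ⋁-upper : ∀ {n} (h : Vec Bool n → Carrier) s → h s ≤ ⋁ h
  ⋁-upper h []          = sym (∧-idem _)
  ⋁-upper h (true ∷ s)  = ≤-trans (⋁-upper (h ∘ (true ∷_)) s) (x≤x∨y _ _)
  ⋁-upper h (false ∷ s) = ≤-trans (⋁-upper (h ∘ (false ∷_)) s) (y≤x∨y _ _)

  ⋁-least : ∀ {n} (h : Vec Bool n → Carrier) {q} → (∀ s → h s ≤ q) → ⋁ h ≤ q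
  ⋁-least {zero}  h p = p []
  ⋁-least {suc n} h p =
    ∨-least (⋁-least (h ∘ (true ∷_)) (p ∘ (true ∷_))) (⋁-least (h ∘ (false ∷_)) (p ∘ (false ∷_)))

  ⋁-atoms : ∀ {n} (γ : Fin n → Carrier) x → x ≈ ⋁ (λ s → atom γ s ∧ x)
  ⋁-atoms {zero}  γ x = sym (∧-identityˡ x)
  ⋁-atoms {suc n} γ x = begin
    x                                   ≈⟨ split (γ zero) x ⟩
    γ zero ∧ x ∨ ¬ γ zero ∧ x           ≈⟨ ∨-cong (⋁-atoms (γ ∘ suc) _) (⋁-atoms (γ ∘ suc) _) ⟩
    ⋁ (λ s → atom (γ ∘ suc) s ∧ (γ zero ∧ x)) ∨ ⋁ (λ s → atom (γ ∘ suc) s ∧ (¬ γ zero ∧ x))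
                                        ≈⟨ ∨-cong (⋁-cong (reassoc (γ zero))) (⋁-cong (reassoc (¬ γ zero))) ⟩
    ⋁ (λ s → atom γ (true ∷ s) ∧ x) ∨ ⋁ (λ s → atom γ (false ∷ s) ∧ x) ∎
    where
      reassoc : ∀ l s → atom (γ ∘ suc) s ∧ (l ∧ x) ≈ (l ∧ atom (γ ∘ suc) s) ∧ x
      reassoc l s = solve (var 0F and (var 1F and var 2F)) ((var 1F and var 0F) and var 2F)
                          (atom (γ ∘ suc) s ∷ l ∷ x ∷ [])

  atom-decides : ∀ {n} (γ : Fin n → Carrier) s i → γ i ≈[ atom γ s ] bit (lookup s i)
  atom-decides γ (true ∷ s)  zero    =
    solve ((var 0F and var 1F) and var 0F) ((var 0F and var 1F) and top) (γ zero ∷ atom (γ ∘ suc) s ∷ [])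
  atom-decides γ (false ∷ s) zero    =
    solve ((not (var 0F) and var 1F) and var 0F) ((not (var 0F) and var 1F) and bot)
          (γ zero ∷ atom (γ ∘ suc) s ∷ [])
  atom-decides γ (b ∷ s)     (suc i) = ≈[]-mono (x∧y≤y _ _) (atom-decides (γ ∘ suc) s i)

  atom-isBit : ∀ {n} {γ : Fin n → Carrier} → (∀ i → IsBit (γ i)) → ∀ s → IsBit (atom γ s)
  atom-isBit bits []      = inj₁ refl
  atom-isBit bits (b ∷ s) = ∧-isBit (lit-isBit b (bits zero)) (atom-isBit (bits ∘ suc) s)

module ClosureAlgebraFacts (A : ClosureAlgebra) where

  open ClosureAlgebra A using (BA; f; f-cong; f-⊥; f-∨; f-incr)
  open BooleanAlgebraFacts BA
  open BooleanSolver BA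
  open Atoms BA

  x≤f[x] : ∀ x → x ≤ f x
  x≤f[x] x = sym (f-incr x)

  f-mono : ∀ {x y} → x ≤ y → f x ≤ f y
  f-mono {x} {y} x≤y = begin
    f x                  ≈⟨ ∧-absorbs-∨ (f x) (f y) ⟨
    f x ∧ (f x ∨ f y)    ≈⟨ ∧-congˡ (f-∨ x y) ⟨
    f x ∧ f (x ∨ y)      ≈⟨ ∧-congˡ (f-cong x∨y≈y) ⟩
    f x ∧ f y            ∎
    where
      x∨y≈y : x ∨ y ≈ y
      x∨y≈y = trans (∨-congʳ x≤y) (solve ((var 0F and var 1F) or var 1F) (var 1F) (x ∷ y ∷ []))

  f-⊤ : f ⊤ ≈ ⊤
  f-⊤ = trans (sym (∧-identityˡ (f ⊤))) (f-incr ⊤)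

  f≈⊥⇒≈⊥ : ∀ {x} → f x ≈ ⊥ → x ≈ ⊥
  f≈⊥⇒≈⊥ {x} fx≈⊥ = begin
    x        ≈⟨ x≤f[x] x ⟩
    x ∧ f x  ≈⟨ ∧-congˡ fx≈⊥ ⟩
    x ∧ ⊥    ≈⟨ ∧-zeroʳ x ⟩
    ⊥        ∎

  f-⋁ : ∀ {n} (h : Vec Bool n → Carrier) → f (⋁ h) ≈ ⋁ (f ∘ h)
  f-⋁ {zero}  h = refl
  f-⋁ {suc n} h = trans (f-∨ _ _) (∨-cong (f-⋁ (h ∘ (true ∷_))) (f-⋁ (h ∘ (false ∷_))))

  leak : Carrier → Carrier
  leak x = f x ∧ ¬ x

  leak-cong : ∀ {x y} → x ≈ y → leak x ≈ leak y
  leak-cong x≈y = ∧-cong (f-cong x≈y) (¬-cong x≈y)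

  leak-isBit : ∀ {x} → IsBit x → leak x ≈ ⊥
  leak-isBit (inj₁ x≈⊤) = trans (∧-congˡ (trans (¬-cong x≈⊤) ¬⊤≈⊥)) (∧-zeroʳ _)
  leak-isBit (inj₂ x≈⊥) = trans (∧-congʳ (trans (f-cong x≈⊥) f-⊥)) (∧-zeroˡ _)

  f-via-leak : ∀ {x m} → leak x ≤ m → f x ≈ x ∨ m ∧ f x
  f-via-leak {x} {m} leak≤m = begin
    f x                 ≈⟨ solve (var 0F) ((var 1F and var 0F) or (var 0F and not (var 1F))) (f x ∷ x ∷ []) ⟩
    x ∧ f x ∨ leak x    ≈⟨ ∨-cong (sym (x≤f[x] x)) leak≤m ⟩
    x ∨ leak x ∧ m      ≈⟨ solve (var 0F or ((var 1F and not (var 0F)) and var 2F))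
                                 (var 0F or (var 2F and var 1F)) (x ∷ f x ∷ m ∷ []) ⟩
    x ∨ m ∧ f x         ∎

  f-∧-isBit : ∀ {e z c} → f e ≈ e ∨ z → IsBit c → f (e ∧ c) ≈ e ∧ c ∨ z ∧ c
  f-∧-isBit {e} {z} {c} fe (inj₁ c≈⊤) = begin
    f (e ∧ c)        ≈⟨ f-cong (∧c≈ e) ⟩
    f e              ≈⟨ fe ⟩
    e ∨ z            ≈⟨ ∨-cong (∧c≈ e) (∧c≈ z) ⟨
    e ∧ c ∨ z ∧ c    ∎
    where
      ∧c≈ : ∀ a → a ∧ c ≈ a
      ∧c≈ a = trans (∧-congˡ c≈⊤) (∧-identityʳ a)
  f-∧-isBit {e} {z} {c} fe (inj₂ c≈⊥) = begin
    f (e ∧ c)        ≈⟨ f-cong (∧c≈⊥ e) ⟩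
    f ⊥              ≈⟨ f-⊥ ⟩
    ⊥                ≈⟨ ∨-identityʳ ⊥ ⟨
    ⊥ ∨ ⊥            ≈⟨ ∨-cong (∧c≈⊥ e) (∧c≈⊥ z) ⟨
    e ∧ c ∨ z ∧ c    ∎
    where
      ∧c≈⊥ : ∀ a → a ∧ c ≈ ⊥
      ∧c≈⊥ a = trans (∧-congˡ c≈⊥) (∧-zeroʳ a)

  f-∧-locallyBit : ∀ {e z x c} → f e ≈ e ∨ z → x ≈[ e ∨ z ] c → IsBit c →
                   f (e ∧ x) ≈ e ∧ x ∨ z ∧ x
  f-∧-locallyBit {e} {z} {x} {c} fe x≈c c-bit = begin
    f (e ∧ x)        ≈⟨ f-cong (≈[]-mono (x≤x∨y e z) x≈c) ⟩
    f (e ∧ c)        ≈⟨ f-∧-isBit fe c-bit ⟩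
    e ∧ c ∨ z ∧ c    ≈⟨ ∨-cong (≈[]-mono (x≤x∨y e z) x≈c) (≈[]-mono (y≤x∨y e z) x≈c) ⟨
    e ∧ x ∨ z ∧ x    ∎

record ClosedFilterStructure (A : ClosureAlgebra) : Set₁ where
  open ClosureAlgebra A using (Carrier; _≈_; _∧_; ⊥; f)
  field
    F        : Carrier → Set
    F-up     : ∀ {x y} → F x → x ∧ y ≈ x → F y
    F-closed : ∀ {x} → F x → f x ≈ x
    f-⊥-or-F : ∀ x → f x ≈ ⊥ ⊎ F (f x)

fma⇒closedFilterStructure : ∀ A → FMA A → ClosedFilterStructure A
fma⇒closedFilterStructure A (inj₁ trivial) = record
  { F = λ _ → Unit ; F-up = λ _ _ → tt ; F-closed = λ _ → trivial _ _ ; f-⊥-or-F = λ _ → inj₂ tt }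
  where open ClosureAlgebra A using (f)
fma⇒closedFilterStructure A (inj₂ (inj₁ (_ , ⊥-or-⊤))) = record
  { F = _≈ ⊤ ; F-up = up ; F-closed = λ x≈⊤ → trans (f-cong x≈⊤) (trans f-⊤ (sym x≈⊤))
  ; f-⊥-or-F = ⊥-or-⊤ ∘ f }
  where
    open ClosureAlgebra A using (BA; f; f-cong)
    open BooleanAlgebraFacts BA
    open ClosureAlgebraFacts A using (f-⊤)
    up : ∀ {x y} → x ≈ ⊤ → x ∧ y ≈ x → y ≈ ⊤
    up {x} {y} x≈⊤ x∧y≈x = begin
      y        ≈⟨ ∧-identityˡ y ⟨
      ⊤ ∧ y    ≈⟨ ∧-congʳ x≈⊤ ⟨
      x ∧ y    ≈⟨ x∧y≈x ⟩
      x        ≈⟨ x≈⊤ ⟩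
      ⊤        ∎
fma⇒closedFilterStructure A (inj₂ (inj₂ (F , isFilter , _ , closed⇔))) = record
  { F = F ; F-up = IsFilter.up isFilter ; F-closed = λ {x} x∈F → proj₂ (closed⇔ x) (inj₂ x∈F)
  ; f-⊥-or-F = λ x → proj₁ (closed⇔ (f x)) (f-idem x) }
  where open ClosureAlgebra A using (f; f-idem)

module Leakage (A : ClosureAlgebra) (S : ClosedFilterStructure A) {n : ℕ}
               (γ : Fin n → ClosureAlgebra.Carrier A) where

  open ClosureAlgebra A using (BA; f; f-cong)
  open BooleanAlgebraFacts BA
  open BooleanSolver BA
  open Atoms BA
  open ClosureAlgebraFacts A
  open ClosedFilterStructure S

  -- q ∨ y lies in F, so it is closed and contains f y.
  leak≤F : ∀ {q} y → F q → leak y ≤ q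
  leak≤F {q} y q∈F = begin
    f y ∧ ¬ y                       ≈⟨ ∧-congʳ fy≤q∨y ⟩
    (f y ∧ (q ∨ y)) ∧ ¬ y           ≈⟨ solve ((var 0F and (var 1F or var 2F)) and not (var 2F))
                                             (((var 0F and (var 1F or var 2F)) and not (var 2F)) and var 1F)
                                             (f y ∷ q ∷ y ∷ []) ⟩
    ((f y ∧ (q ∨ y)) ∧ ¬ y) ∧ q     ≈⟨ ∧-congʳ (∧-congʳ fy≤q∨y) ⟨
    (f y ∧ ¬ y) ∧ q                 ∎
    where
      fy≤q∨y : f y ≤ q ∨ y
      fy≤q∨y = trans (f-mono (y≤x∨y q y)) (∧-congˡ (F-closed (F-up q∈F (∧-absorbs-∨ q y))))

  α : Vec Bool n → Carrier
  α = atom γ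

  leakage : Carrier
  leakage = ⋁ (λ s → leak (α s) ∨ leak (¬ α s))

  leak-atom≤leakage : ∀ s → leak (α s) ≤ leakage
  leak-atom≤leakage s = ≤-trans (x≤x∨y _ _) (⋁-upper (λ s → leak (α s) ∨ leak (¬ α s)) s)

  leak-coatom≤leakage : ∀ s → leak (¬ α s) ≤ leakage
  leak-coatom≤leakage s = ≤-trans (y≤x∨y _ _) (⋁-upper (λ s → leak (α s) ∨ leak (¬ α s)) s)

  leakage≤F : ∀ {q} → F q → leakage ≤ q
  leakage≤F q∈F = ⋁-least _ (λ s → ∨-least (leak≤F (α s) q∈F) (leak≤F (¬ α s) q∈F))

  f-isBit-below-leakage : ∀ w → Σ Bool λ b → f w ≈[ leakage ] bit b
  f-isBit-below-leakage w with f-⊥-or-F w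
  ... | inj₁ fw≈⊥ = false , ∧-congˡ fw≈⊥
  ... | inj₂ fw∈F = true , trans (sym (leakage≤F fw∈F)) (sym (∧-identityʳ leakage))

  -- If one atom is ⊤, every generator and hence every atom is ⊥ or ⊤, so all leaks vanish.
  leakage≈⊥ : ∀ s → α s ≈ ⊤ → leakage ≈ ⊥
  leakage≈⊥ s αs≈⊤ =
    ≤⊥⇒≈⊥ (⋁-least _ λ t → ∨-least (leak≤⊥ (α-isBit t)) (leak≤⊥ (¬-isBit (α-isBit t))))
    where
      γ-isBit : ∀ i → IsBit (γ i)
      γ-isBit i = isBit-resp (begin
        bit (lookup s i)          ≈⟨ ∧-identityˡ _ ⟨
        ⊤ ∧ bit (lookup s i)      ≈⟨ ∧-congʳ αs≈⊤ ⟨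
        α s ∧ bit (lookup s i)    ≈⟨ atom-decides γ s i ⟨
        α s ∧ γ i                 ≈⟨ ∧-congʳ αs≈⊤ ⟩
        ⊤ ∧ γ i                   ≈⟨ ∧-identityˡ _ ⟩
        γ i                       ∎) (bit-isBit (lookup s i))
      α-isBit : ∀ t → IsBit (α t)
      α-isBit = atom-isBit γ-isBit
      leak≤⊥ : ∀ {x} → IsBit x → leak x ≤ ⊥
      leak≤⊥ x-bit = ≤-respˡ-≈ (sym (leak-isBit x-bit)) (⊥≤ ⊥)

  γ⁺ : Fin (suc n) → Carrier
  γ⁺ zero    = leakage
  γ⁺ (suc i) = γ i

  -- cell (b ∷ s) is α s split along leakage.
  cell : Vec Bool (suc n) → Carrier
  cell = atom γ⁺

  spill : Vec Bool (suc n) → Carrier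
  spill c = leakage ∧ f (cell c)

  leak-cell≤leakage : ∀ c → leak (cell c) ≤ leakage
  leak-cell≤leakage (b ∷ s) = ≤-respˡ-≈ (sym (split (α s) (leak y))) (∨-least inside outside)
    where
      y : Carrier
      y = lit b leakage ∧ α s
      outside : ¬ α s ∧ leak y ≤ leakage
      outside = ≤-trans (∧-greatest (≤-trans (≤-trans (x∧y≤y _ _) (x∧y≤x _ _)) (f-mono (x∧y≤y _ _)))
                                    (x∧y≤x _ _))
                        (leak-atom≤leakage s)
      inside : α s ∧ leak y ≤ leakage
      inside with f-⊥-or-F (¬ α s)
      ... | inj₂ f¬α∈F = ≤-trans (∧-greatest (≤-trans (x∧y≤y _ _) (leak≤F y f¬α∈F))
                                             (≤-respʳ-≈ (sym (¬-involutive (α s))) (x∧y≤x _ _)))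
                                 (leak-coatom≤leakage s)
      ... | inj₁ f¬α≈⊥ = ≤-respˡ-≈ (sym (trans (∧-congˡ (leak-isBit y-isBit)) (∧-zeroʳ _))) (⊥≤ _)
        where
          αs≈⊤ : α s ≈ ⊤
          αs≈⊤ = ¬≈⊥⇒≈⊤ (f≈⊥⇒≈⊥ f¬α≈⊥)
          y-isBit : IsBit y
          y-isBit = ∧-isBit (lit-isBit b (inj₂ (leakage≈⊥ s αs≈⊤))) (inj₁ αs≈⊤)

  f-cell : ∀ c → f (cell c) ≈ cell c ∨ spill c
  f-cell c = f-via-leak (leak-cell≤leakage c)

litₜ : ∀ {m} → Bool → Term m → Term m
litₜ true  x = x
litₜ false x = ¬ₜ x

atomₜ : ∀ {k m} → (Fin k → Term m) → Vec Bool k → Term m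
atomₜ w []      = ⊤ₜ
atomₜ w (b ∷ s) = litₜ b (w zero) ∧ₜ atomₜ (w ∘ suc) s

⋁ₜ : ∀ {k m} → (Vec Bool k → Term m) → Term m
⋁ₜ = foldSigns _∨ₜ_

leakₜ : ∀ {m} → Term m → Term m
leakₜ x = fₜ x ∧ₜ (¬ₜ x)

treeₜ : ∀ {X : Set} {xs : List X} {m} → (X → Term m) → DecisionTree.Tree xs → Term m
treeₜ g (DecisionTree.leaf true)        = ⊤ₜ
treeₜ g (DecisionTree.leaf false)       = ⊥ₜ
treeₜ g (DecisionTree.node {x} a₁ a₀)  = (g x ∧ₜ treeₜ g a₁) ∨ₜ ((¬ₜ g x) ∧ₜ treeₜ g a₀)

signs : ∀ k → List (Vec Bool k)
signs zero    = [] ∷ []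
signs (suc k) = cartesianProductWith _∷_ (true ∷ false ∷ []) (signs k)

∈-signs : ∀ {k} (s : Vec Bool k) → s ∈ signs k
∈-signs []          = here ≡.refl
∈-signs (true ∷ s)  = ∈-cartesianProductWith⁺ _∷_ {xs = true ∷ false ∷ []} (here ≡.refl) (∈-signs s)
∈-signs (false ∷ s) =
  ∈-cartesianProductWith⁺ _∷_ {xs = true ∷ false ∷ []} (there (here ≡.refl)) (∈-signs s)

leakageₜ : ∀ {n} → Term n
leakageₜ = ⋁ₜ (λ s → leakₜ (atomₜ var s) ∨ₜ leakₜ (¬ₜ atomₜ var s))

γ⁺ₜ : ∀ {n} → Fin (suc n) → Term n
γ⁺ₜ zero    = leakageₜ
γ⁺ₜ (suc i) = var i

spillₜ : ∀ {n} → Vec Bool (suc n) → Term n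
spillₜ c = leakageₜ ∧ₜ fₜ (atomₜ γ⁺ₜ c)

data Generator (n : ℕ) : Set where
  base   : Fin (suc n) → Generator n
  spillᵍ : Vec Bool (suc n) → Generator n

generatorₜ : ∀ {n} → Generator n → Term n
generatorₜ (base j)   = γ⁺ₜ j
generatorₜ (spillᵍ c) = spillₜ c

generators : ∀ n → List (Generator n)
generators n = List.map base (allFin (suc n)) ++ List.map spillᵍ (signs (suc n))

∈-generators : ∀ {n} (x : Generator n) → x ∈ generators n
∈-generators (base j)   = ∈-++⁺ˡ (∈-map⁺ base (∈-allFin j))
∈-generators (spillᵍ c) = ∈-++⁺ʳ (List.map base (allFin _)) (∈-map⁺ spillᵍ (∈-signs c))

module NormalForm (n : ℕ) where

  open DecisionTree {Generator n} public

  NF : Set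
  NF = Tree (generators n)

  -- Values of the generators on cell c; inside leakage the spills are not fixed syntactically.
  assignment : Vec Bool (suc n) → Generator n → Maybe Bool
  assignment c           (base j)   = just (lookup c j)
  assignment (true ∷ _)  (spillᵍ _) = nothing
  assignment (false ∷ _) (spillᵍ _) = just false

  fᴺ : NF → NF
  fᴺ a = a ∨ᵗ foldSigns _∨ᵗ_ (λ c → varᵗ (∈-generators (spillᵍ c)) ∧ᵗ restrict (assignment c) a)

  nf : Term n → NF
  nf (var i)  = varᵗ (∈-generators (base (suc i)))
  nf (a ∨ₜ b) = nf a ∨ᵗ nf b
  nf (a ∧ₜ b) = nf a ∧ᵗ nf b
  nf (¬ₜ a)   = ¬ᵗ nf a
  nf (fₜ a)   = fᴺ (nf a)
  nf ⊤ₜ       = constᵗ true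
  nf ⊥ₜ       = constᵗ false

  normalForm : Term n → Term n
  normalForm t = treeₜ generatorₜ (nf t)

module NormalFormSoundness (A : ClosureAlgebra) (S : ClosedFilterStructure A) {n : ℕ}
                           (γ : Fin n → ClosureAlgebra.Carrier A) where

  open ClosureAlgebra A using (BA; f; f-cong)
  open BooleanAlgebraFacts BA
  open BooleanSolver BA
  open Atoms BA
  open ClosureAlgebraFacts A
  open TreeSemantics BA
  open Leakage A S γ
  open NormalForm n

  ⟦_⟧ᴬ : Term n → Carrier
  ⟦ t ⟧ᴬ = ⟦_⟧ A t γ

  u : Generator n → Carrier
  u x = ⟦ generatorₜ x ⟧ᴬ

  ⟦⋁ₜ⟧ : ∀ {k} (h : Vec Bool k → Term n) → ⟦ ⋁ₜ h ⟧ᴬ ≡ ⋁ (λ s → ⟦ h s ⟧ᴬ)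
  ⟦⋁ₜ⟧ {zero}  h = ≡.refl
  ⟦⋁ₜ⟧ {suc k} h = ≡.cong₂ _∨_ (⟦⋁ₜ⟧ (h ∘ (true ∷_))) (⟦⋁ₜ⟧ (h ∘ (false ∷_)))

  ⟦atomₜ⟧ : ∀ {k} {w : Fin k → Term n} {δ : Fin k → Carrier} →
            (∀ i → ⟦ w i ⟧ᴬ ≈ δ i) → ∀ s → ⟦ atomₜ w s ⟧ᴬ ≈ atom δ s
  ⟦atomₜ⟧ p []          = refl
  ⟦atomₜ⟧ p (true ∷ s)  = ∧-cong (p zero) (⟦atomₜ⟧ (p ∘ suc) s)
  ⟦atomₜ⟧ p (false ∷ s) = ∧-cong (¬-cong (p zero)) (⟦atomₜ⟧ (p ∘ suc) s)

  ⟦leakageₜ⟧ : ⟦ leakageₜ ⟧ᴬ ≈ leakage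
  ⟦leakageₜ⟧ = trans (reflexive (⟦⋁ₜ⟧ (λ s → leakₜ (atomₜ var s) ∨ₜ leakₜ (¬ₜ atomₜ var s))))
                     (⋁-cong λ s → ∨-cong (leak-cong (⟦atom⟧ s)) (leak-cong (¬-cong (⟦atom⟧ s))))
    where
      ⟦atom⟧ : ∀ s → ⟦ atomₜ var s ⟧ᴬ ≈ α s
      ⟦atom⟧ = ⟦atomₜ⟧ {w = var} (λ _ → refl)

  ⟦γ⁺ₜ⟧ : ∀ j → ⟦ γ⁺ₜ j ⟧ᴬ ≈ γ⁺ j
  ⟦γ⁺ₜ⟧ zero    = ⟦leakageₜ⟧
  ⟦γ⁺ₜ⟧ (suc i) = refl

  u-spill : ∀ c → u (spillᵍ c) ≈ spill c
  u-spill c = ∧-cong ⟦leakageₜ⟧ (f-cong (⟦atomₜ⟧ ⟦γ⁺ₜ⟧ c))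

  u≈[cell]override : ∀ c x → u x ≈[ cell c ] override u (assignment c) x
  u≈[cell]override c           (base j)   = trans (∧-congˡ (⟦γ⁺ₜ⟧ j)) (atom-decides γ⁺ c j)
  u≈[cell]override (true ∷ s)  (spillᵍ d) = refl
  u≈[cell]override (false ∷ s) (spillᵍ d) = trans (∧-congˡ (u-spill d))
    (solve ((not (var 0F) and var 1F) and (var 0F and var 2F)) ((not (var 0F) and var 1F) and bot)
           (leakage ∷ α s ∷ f (cell d) ∷ []))

  bits : Vec Bool (suc n) → Generator n → Carrier
  bits c           (base j)   = bit (lookup c j)
  bits (true ∷ _)  (spillᵍ d) = bit (proj₁ (f-isBit-below-leakage (cell d)))
  bits (false ∷ _) (spillᵍ d) = ⊥

  bits-isBit : ∀ c x → IsBit (bits c x)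
  bits-isBit c           (base j)   = bit-isBit (lookup c j)
  bits-isBit (true ∷ _)  (spillᵍ d) = bit-isBit (proj₁ (f-isBit-below-leakage (cell d)))
  bits-isBit (false ∷ _) (spillᵍ d) = inj₂ refl

  override≈[]bits : ∀ c x → override u (assignment c) x ≈[ cell c ∨ spill c ] bits c x
  override≈[]bits c           (base j)   = refl
  override≈[]bits (false ∷ s) (spillᵍ d) = refl
  override≈[]bits (true ∷ s)  (spillᵍ d) = ≈[]-mono (∨-least (x∧y≤x _ _) (x∧y≤x _ _)) (begin
    leakage ∧ u (spillᵍ d)                    ≈⟨ ∧-congˡ (u-spill d) ⟩
    leakage ∧ (leakage ∧ f (cell d))          ≈⟨ ∧-assoc _ _ _ ⟨
    (leakage ∧ leakage) ∧ f (cell d)          ≈⟨ ∧-congʳ (∧-idem _) ⟩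
    leakage ∧ f (cell d)                      ≈⟨ proj₂ (f-isBit-below-leakage (cell d)) ⟩
    leakage ∧ bit (proj₁ (f-isBit-below-leakage (cell d))) ∎)

  f-cell-∧ : ∀ (a : NF) c →
             f (cell c ∧ ⟦ a ⟧ᵗ u) ≈ cell c ∧ ⟦ a ⟧ᵗ u ∨ spill c ∧ ⟦ restrict (assignment c) a ⟧ᵗ u
  f-cell-∧ a c = begin
    f (cell c ∧ ⟦ a ⟧ᵗ u)    ≈⟨ f-cong on-cell ⟩
    f (cell c ∧ R)           ≈⟨ f-∧-locallyBit (f-cell c) R≈bits (⟦⟧ᵗ-isBit a (bits-isBit c)) ⟩
    cell c ∧ R ∨ spill c ∧ R ≈⟨ ∨-congʳ on-cell ⟨
    cell c ∧ ⟦ a ⟧ᵗ u ∨ spill c ∧ R ∎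
    where
      R : Carrier
      R = ⟦ restrict (assignment c) a ⟧ᵗ u
      on-cell : ⟦ a ⟧ᵗ u ≈[ cell c ] R
      on-cell = trans (⟦⟧ᵗ-local a (u≈[cell]override c)) (∧-congˡ (sym (⟦restrict⟧ _ a u)))
      R≈bits : R ≈[ cell c ∨ spill c ] ⟦ a ⟧ᵗ (bits c)
      R≈bits = trans (∧-congˡ (⟦restrict⟧ _ a u)) (⟦⟧ᵗ-local a (override≈[]bits c))

  ⟦foldSigns∨ᵗ⟧ : ∀ {k} (h : Vec Bool k → NF) → ⟦ foldSigns _∨ᵗ_ h ⟧ᵗ u ≈ ⋁ (λ s → ⟦ h s ⟧ᵗ u)
  ⟦foldSigns∨ᵗ⟧ {zero}  h = refl
  ⟦foldSigns∨ᵗ⟧ {suc k} h =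
    trans (⟦∨ᵗ⟧ (foldSigns _∨ᵗ_ (h ∘ (true ∷_))) (foldSigns _∨ᵗ_ (h ∘ (false ∷_))) u)
          (∨-cong (⟦foldSigns∨ᵗ⟧ (h ∘ (true ∷_))) (⟦foldSigns∨ᵗ⟧ (h ∘ (false ∷_))))

  ⟦fᴺ⟧ : ∀ a → f (⟦ a ⟧ᵗ u) ≈ ⟦ fᴺ a ⟧ᵗ u
  ⟦fᴺ⟧ a = begin
    f x                                           ≈⟨ f-cong (⋁-atoms γ⁺ x) ⟩
    f (⋁ (λ c → cell c ∧ x))                      ≈⟨ f-⋁ (λ c → cell c ∧ x) ⟩
    ⋁ (λ c → f (cell c ∧ x))                      ≈⟨ ⋁-cong (f-cell-∧ a) ⟩
    ⋁ (λ c → cell c ∧ x ∨ spill c ∧ R c)          ≈⟨ ⋁-∨ (λ c → cell c ∧ x) (λ c → spill c ∧ R c) ⟩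
    ⋁ (λ c → cell c ∧ x) ∨ ⋁ (λ c → spill c ∧ R c) ≈⟨ ∨-cong (⋁-atoms γ⁺ x) (⋁-cong spill-term) ⟨
    x ∨ ⋁ (λ c → ⟦ spillTree c ⟧ᵗ u)              ≈⟨ ∨-congˡ (⟦foldSigns∨ᵗ⟧ spillTree) ⟨
    x ∨ ⟦ foldSigns _∨ᵗ_ spillTree ⟧ᵗ u           ≈⟨ ⟦∨ᵗ⟧ a _ u ⟨
    ⟦ fᴺ a ⟧ᵗ u                                   ∎
    where
      x : Carrier
      x = ⟦ a ⟧ᵗ u
      R : Vec Bool (suc n) → Carrier
      R c = ⟦ restrict (assignment c) a ⟧ᵗ u
      spillTree : Vec Bool (suc n) → NF
      spillTree c = varᵗ (∈-generators (spillᵍ c)) ∧ᵗ restrict (assignment c) a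
      spill-term : ∀ c → ⟦ spillTree c ⟧ᵗ u ≈ spill c ∧ R c
      spill-term c = trans (⟦∧ᵗ⟧ (varᵗ (∈-generators (spillᵍ c))) (restrict (assignment c) a) u)
                             (∧-congʳ (trans (⟦varᵗ⟧ (∈-generators (spillᵍ c)) u) (u-spill c)))

  nf-sound : ∀ t → ⟦ t ⟧ᴬ ≈ ⟦ nf t ⟧ᵗ u
  nf-sound (var i)  = sym (⟦varᵗ⟧ (∈-generators (base (suc i))) u)
  nf-sound (a ∨ₜ b) = trans (∨-cong (nf-sound a) (nf-sound b)) (sym (⟦∨ᵗ⟧ (nf a) (nf b) u))
  nf-sound (a ∧ₜ b) = trans (∧-cong (nf-sound a) (nf-sound b)) (sym (⟦∧ᵗ⟧ (nf a) (nf b) u))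
  nf-sound (¬ₜ a)   = trans (¬-cong (nf-sound a)) (sym (⟦¬ᵗ⟧ (nf a) u))
  nf-sound (fₜ a)   = trans (f-cong (nf-sound a)) (⟦fᴺ⟧ (nf a))
  nf-sound ⊤ₜ       = sym (⟦constᵗ⟧ {xs = generators n} true u)
  nf-sound ⊥ₜ       = sym (⟦constᵗ⟧ {xs = generators n} false u)

  ⟦treeₜ⟧ : ∀ {xs} (a : Tree xs) → ⟦ treeₜ generatorₜ a ⟧ᴬ ≡ ⟦ a ⟧ᵗ u
  ⟦treeₜ⟧ (leaf true)      = ≡.refl
  ⟦treeₜ⟧ (leaf false)     = ≡.refl
  ⟦treeₜ⟧ (node {x} a₁ a₀) = ≡.cong₂ (ite (u x)) (⟦treeₜ⟧ a₁) (⟦treeₜ⟧ a₀)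

  normalForm-sound : ∀ t → ⟦ t ⟧ᴬ ≈ ⟦ normalForm t ⟧ᴬ
  normalForm-sound t = trans (nf-sound t) (reflexive (≡.sym (⟦treeₜ⟧ (nf t))))

_⊧_≈ₜ_ : ∀ {n} → ClosureAlgebra → Term n → Term n → Set
A ⊧ s ≈ₜ t = ∀ γ → ClosureAlgebra._≈_ A (⟦_⟧ A s γ) (⟦_⟧ A t γ)

_⊫_≈ₜ_ : ∀ {n} → Class → Term n → Term n → Set₁
K ⊫ s ≈ₜ t = ∀ A → K A → A ⊧ s ≈ₜ t

⟦⟧-cong : ∀ A {n} (t : Term n) {γ γ′ : Fin n → ClosureAlgebra.Carrier A} →
          (∀ i → ClosureAlgebra._≈_ A (γ i) (γ′ i)) → ClosureAlgebra._≈_ A (⟦_⟧ A t γ) (⟦_⟧ A t γ′)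
⟦⟧-cong A (var i)  p = p i
⟦⟧-cong A (a ∨ₜ b) p = ClosureAlgebra.∨-cong A (⟦⟧-cong A a p) (⟦⟧-cong A b p)
⟦⟧-cong A (a ∧ₜ b) p = ClosureAlgebra.∧-cong A (⟦⟧-cong A a p) (⟦⟧-cong A b p)
⟦⟧-cong A (¬ₜ a)   p = ClosureAlgebra.¬-cong A (⟦⟧-cong A a p)
⟦⟧-cong A (fₜ a)   p = ClosureAlgebra.f-cong A (⟦⟧-cong A a p)
⟦⟧-cong A ⊤ₜ       p = ClosureAlgebra.refl A
⟦⟧-cong A ⊥ₜ       p = ClosureAlgebra.refl A

module _ {A B : ClosureAlgebra} (h : Hom A B) where

  open ClosureAlgebra B
  open Hom h

  map-⟦⟧ : ∀ {n} (t : Term n) γ → map (⟦_⟧ A t γ) ≈ ⟦_⟧ B t (map ∘ γ)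
  map-⟦⟧ (var i)  γ = refl
  map-⟦⟧ (a ∨ₜ b) γ = trans (pres-∨ _ _) (∨-cong (map-⟦⟧ a γ) (map-⟦⟧ b γ))
  map-⟦⟧ (a ∧ₜ b) γ = trans (pres-∧ _ _) (∧-cong (map-⟦⟧ a γ) (map-⟦⟧ b γ))
  map-⟦⟧ (¬ₜ a)   γ = trans (pres-¬ _) (¬-cong (map-⟦⟧ a γ))
  map-⟦⟧ (fₜ a)   γ = trans (pres-f _) (f-cong (map-⟦⟧ a γ))
  map-⟦⟧ ⊤ₜ       γ = pres-⊤
  map-⟦⟧ ⊥ₜ       γ = pres-⊥

module _ {n : ℕ} {s t : Term n} where

  P-preserves-⊫ : ∀ {K} → K ⊫ s ≈ₜ t → P K ⊫ s ≈ₜ t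
  P-preserves-⊫ K⊫s≈t A (I , B , B∈K , π , jointlyInjective , _) γ = jointlyInjective _ _ λ i →
    let module Bᵢ = ClosureAlgebra (B i) in
    Bᵢ.trans (map-⟦⟧ (π i) s γ) (Bᵢ.trans (K⊫s≈t (B i) (B∈K i) _) (Bᵢ.sym (map-⟦⟧ (π i) t γ)))

  S-preserves-⊫ : ∀ {K} → K ⊫ s ≈ₜ t → S K ⊫ s ≈ₜ t
  S-preserves-⊫ K⊫s≈t A (B , B∈K , e , injective) γ =
    injective (B.trans (map-⟦⟧ e s γ) (B.trans (K⊫s≈t B B∈K _) (B.sym (map-⟦⟧ e t γ))))
    where module B = ClosureAlgebra B

  H-preserves-⊫ : ∀ {K} → K ⊫ s ≈ₜ t → H K ⊫ s ≈ₜ t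
  H-preserves-⊫ K⊫s≈t A (B , B∈K , h , surjective) γ = begin
    ⟦_⟧ A s γ                  ≈⟨ ⟦⟧-cong A s preimage ⟨
    ⟦_⟧ A s (Hom.map h ∘ γ′)   ≈⟨ map-⟦⟧ h s γ′ ⟨
    Hom.map h (⟦_⟧ B s γ′)     ≈⟨ Hom.cong h (K⊫s≈t B B∈K γ′) ⟩
    Hom.map h (⟦_⟧ B t γ′)     ≈⟨ map-⟦⟧ h t γ′ ⟩
    ⟦_⟧ A t (Hom.map h ∘ γ′)   ≈⟨ ⟦⟧-cong A t preimage ⟩
    ⟦_⟧ A t γ                  ∎
    where
      open ClosureAlgebra A using (_≈_; setoid)
      open SetoidReasoning setoid
      γ′ : Fin n → ClosureAlgebra.Carrier B
      γ′ i = proj₁ (surjective (γ i))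
      preimage : ∀ i → Hom.map h (γ′ i) ≈ γ i
      preimage i = proj₂ (surjective (γ i))

  Eq-preserves-⊫ : ∀ {K} → K ⊫ s ≈ₜ t → Eq K ⊫ s ≈ₜ t
  Eq-preserves-⊫ = H-preserves-⊫ ∘ S-preserves-⊫ ∘ P-preserves-⊫

finitelyManyNormalForms⇒locallyFinite : ∀ {K} →
  (∀ n → Σ (List (Term n)) λ ts → ∀ t → Any (K ⊫ t ≈ₜ_) ts) → LocallyFinite K
finitelyManyNormalForms⇒locallyFinite {K} normalForms A A∈K (n , γ , generated) =
  length ts , (λ i → ⟦_⟧ A (List.lookup ts i) γ) , covered
  where
    open ClosureAlgebra A using (_≈_; trans; sym)
    ts : List (Term n)
    ts = proj₁ (normalForms n)
    covered : ∀ a → ∃ λ i → ⟦_⟧ A (List.lookup ts i) γ ≈ a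
    covered a with generated a
    ... | t , ⟦t⟧≈a = index t≈ts , trans (sym (lookup-index t≈ts A A∈K γ)) ⟦t⟧≈a
      where
        t≈ts : Any (K ⊫ t ≈ₜ_) ts
        t≈ts = proj₂ (normalForms n) t

filterAlgebras⊫normalForm : ∀ {n} (t : Term n) → FMA ⊫ t ≈ₜ NormalForm.normalForm n t
filterAlgebras⊫normalForm t B B∈FMA γ =
  NormalFormSoundness.normalForm-sound B (fma⇒closedFilterStructure B B∈FMA) γ t

theorem5p7 : LocallyFinite (Eq FMA)
theorem5p7 = finitelyManyNormalForms⇒locallyFinite λ n →
  let open NormalForm n in
  List.map (treeₜ generatorₜ) (trees (generators n)) ,
  λ t → lose (∈-map⁺ (treeₜ generatorₜ) (∈-trees (nf t)))
             (Eq-preserves-⊫ {s = t} {t = normalForm t} (filterAlgebras⊫normalForm t))
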